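{- For every $k\geq 3$, the prism $P_k$ over a $k$-cycle belongs to $\mathcal{G}_s^w$. In particular, for every even $n\geq 6$ there is a $3$-regular $n$-vertex graph in $\mathcal{G}_s^w$.
   Context: The prism $P_k$ over a $k$-cycle is the Cartesian product $C_k\times K_2$ (two disjoint $k$-cycles $a_1\cdots a_k$ and $b_1\cdots b_k$ plus the edges $a_ib_i$); it is $3$-regular. A finite point set $X\subseteq\mathbb{R}^2$ is strictly convex if every point of $X$ is a vertex of its convex hull, and weakly convex if $X$ lies on the boundary of its convex hull. A drawing of a graph is a map of its vertices to $\mathbb{R}^2$, edges drawn as straight segments, such that no two vertices coincide, no two edge midpoints coincide, and no edge midpoint coincides with a vertex. $\mathcal{G}_s^w$ is the class of graphs admitting a drawing whose vertex set is strictly convex and whose edge-midpoint set is weakly convex. -}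

module Defs where

open import Level using (0ℓ)
open import Data.Nat as ℕ using (ℕ; zero; suc)
open import Data.Fin using (Fin; toℕ; splitAt)
open import Data.List using (List; []; _∷_; foldr; _++_; [_]; allFin; cartesianProduct)
open import Data.Vec using (Vec; toList)
open import Data.Product using (_×_; _,_; ∃; Σ)
open import Data.Sum using (_⊎_; inj₁; inj₂)
open import Relation.Nullary using (¬_)
open import Relation.Binary.PropositionalEquality using (_≡_; _≢_)
open import Relation.Binary.Core using (Rel)
open import Relation.Binary.Structures using (IsStrictTotalOrder)
open import Algebra.Core using (Op₁; Op₂)
open import Algebra.Structures using (IsCommutativeRing)

hornerWith : {A : Set} → Op₂ A → Op₂ A → A → List A → A → A
hornerWith _+_ _*_ 0# cs x = foldr (λ c acc → c + (x * acc)) 0# cs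

-- Real closed fields: ordered fields in which every positive element
-- has a square root and every odd-degree polynomial has a root.
-- (Stand-in for ℝ; the statement for a fixed k is first-order, so by
-- Tarski transfer it holds over ℝ iff it holds over every RCF.)
record RealClosedField : Set₁ where
  infixl 6 _+_
  infixl 7 _*_
  infix 4 _<_
  field
    Carrier : Set
    _+_ _*_ : Op₂ Carrier
    -_      : Op₁ Carrier
    0# 1#   : Carrier
    inv     : Op₁ Carrier
    _<_     : Rel Carrier 0ℓ
    isCommutativeRing : IsCommutativeRing _≡_ _+_ _*_ -_ 0# 1#
    0≢1          : 0# ≢ 1#
    inv-correct  : ∀ x → x ≢ 0# → x * inv x ≡ 1#
    isStrictTotalOrder : IsStrictTotalOrder _≡_ _<_
    +-mono-<     : ∀ {x y} z → x < y → x + z < y + z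
    *-pos        : ∀ {x y} → 0# < x → 0# < y → 0# < x * y
    sqrt-exists  : ∀ x → 0# < x → ∃ λ y → y * y ≡ x
    odd-root     : ∀ n (cs : Vec Carrier (suc (n ℕ.+ n))) →
                   ∃ λ x → hornerWith _+_ _*_ 0# (toList cs ++ [ 1# ]) x ≡ 0#

module Geometry (R : RealClosedField) where
  open RealClosedField R

  _≤_ : Carrier → Carrier → Set
  x ≤ y = x < y ⊎ x ≡ y

  _-_ : Carrier → Carrier → Carrier
  x - y = x + (- y)

  Point : Set
  Point = Carrier × Carrier

  half : Carrier
  half = inv (1# + 1#)

  midpoint : Point → Point → Point
  midpoint (x₁ , y₁) (x₂ , y₂) = (half * (x₁ + x₂) , half * (y₁ + y₂))

  dist² : Point → Point → Carrier
  dist² (x₁ , y₁) (x₂ , y₂) = (x₁ - x₂) * (x₁ - x₂) + (y₁ - y₂) * (y₁ - y₂)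

  sumOver : {I : Set} → List I → (I → Carrier) → Carrier
  sumOver is f = foldr (λ i acc → f i + acc) 0# is

  InConvHull : {I : Set} → List I → (I → Set) → (I → Point) → Point → Set
  InConvHull is S p z =
    Σ (_ → Carrier) λ w →
      (∀ i → 0# ≤ w i) ×
      (∀ i → w i ≢ 0# → S i) ×
      (sumOver is w ≡ 1#) ×
      (sumOver is (λ i → w i * Data.Product.proj₁ (p i)) ≡ Data.Product.proj₁ z) ×
      (sumOver is (λ i → w i * Data.Product.proj₂ (p i)) ≡ Data.Product.proj₂ z)

  InInteriorOfHull : {I : Set} → List I → (I → Set) → (I → Point) → Point → Set
  InInteriorOfHull is S p z =
    Σ Carrier λ ε → (0# < ε) ×
      (∀ y → dist² y z < ε * ε → InConvHull is S p y)

  -- A straight-line drawing of a graph on Fin n (adjacency Adj) whose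
  -- vertex set is strictly convex and whose edge-midpoint set is weakly
  -- convex.
  record SWDrawing (n : ℕ) (Adj : Fin n → Fin n → Set) : Set where
    field
      pos : Fin n → Point
      pos-injective : ∀ u v → u ≢ v → pos u ≢ pos v
      mid-injective : ∀ u v u′ v′ → Adj u v → Adj u′ v′ →
                      midpoint (pos u) (pos v) ≡ midpoint (pos u′) (pos v′) →
                      (u ≡ u′ × v ≡ v′) ⊎ (u ≡ v′ × v ≡ u′)
      mid-not-vertex : ∀ u v w → Adj u v → midpoint (pos u) (pos v) ≢ pos w
      -- vertex set strictly convex: each vertex is a vertex of the hull,
      -- i.e. not in the convex hull of the other vertices
      strictly-convex : ∀ v → ¬ InConvHull (allFin n) (λ u → u ≢ v) pos (pos v)
      -- midpoint set weakly convex: every midpoint lies on the boundary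
      -- of the convex hull of all midpoints (i.e. not in its interior)
      weakly-convex : ∀ u v → Adj u v →
        ¬ InInteriorOfHull (cartesianProduct (allFin n) (allFin n))
                           (λ e → Adj (Data.Product.proj₁ e) (Data.Product.proj₂ e))
                           (λ e → midpoint (pos (Data.Product.proj₁ e)) (pos (Data.Product.proj₂ e)))
                           (midpoint (pos u) (pos v))

InGsw : RealClosedField → (n : ℕ) → (Fin n → Fin n → Set) → Set
InGsw R n Adj = Geometry.SWDrawing R n Adj

record SimpleGraph (n : ℕ) : Set₁ where
  field
    Adj   : Fin n → Fin n → Set
    sym   : ∀ {u v} → Adj u v → Adj v u
    irrefl : ∀ {u} → ¬ Adj u u

Degree3 : {n : ℕ} → (Fin n → Fin n → Set) → Fin n → Set
Degree3 {n} Adj v =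
  Σ (Fin n) λ a → Σ (Fin n) λ b → Σ (Fin n) λ c →
    (a ≢ b) × (a ≢ c) × (b ≢ c) × Adj v a × Adj v b × Adj v c ×
    (∀ u → Adj v u → (u ≡ a) ⊎ (u ≡ b) ⊎ (u ≡ c))

ThreeRegular : {n : ℕ} → SimpleGraph n → Set
ThreeRegular G = ∀ v → Degree3 (SimpleGraph.Adj G) v

CycleAdj : (k : ℕ) → Fin k → Fin k → Set
CycleAdj k i j =
  (suc (toℕ i) ≡ toℕ j) ⊎ (suc (toℕ j) ≡ toℕ i) ⊎
  ((toℕ i ≡ 0) × (suc (toℕ j) ≡ k)) ⊎ ((toℕ j ≡ 0) × (suc (toℕ i) ≡ k))

-- prism P_k = C_k × K₂ on Fin (k + k): index i < k is a_i, index k + i is b_i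
PrismAdj′ : (k : ℕ) → Fin k ⊎ Fin k → Fin k ⊎ Fin k → Set
PrismAdj′ k (inj₁ i) (inj₁ j) = CycleAdj k i j
PrismAdj′ k (inj₂ i) (inj₂ j) = CycleAdj k i j
PrismAdj′ k (inj₁ i) (inj₂ j) = i ≡ j
PrismAdj′ k (inj₂ i) (inj₁ j) = i ≡ j

PrismAdj : (k : ℕ) → Fin (k ℕ.+ k) → Fin (k ℕ.+ k) → Set
PrismAdj k u v = PrismAdj′ k (splitAt k u) (splitAt k v)

module Submission where

-- Put a_i and b_i at the points of the parabola y = x² with abscissae 2i and 2i + 1; points on
-- a parabola are in strictly convex position.  Each edge midpoint (X , Y) lies on a line having
-- all edge midpoints on one side.  For the rung a_i b_i and the edges a_i a_{i+1}, b_i b_{i+1} it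
-- is 4uX + 5 = 4Y + u² with u = 4i + 3: at the midpoint of the labels s and t the slack is
-- ((2s − u)² + (2t − u)² − 10) / 2, negative only if both labels lie in {2i + 1 , 2i + 2}, and
-- no edge joins these two.  For the closing edges a_0 a_{k−1} and b_0 b_{k−1} it is
-- 2X + 2Y + n = 2nX + 2 with n = 2k, where the slack is nonnegative unless both labels are
-- extreme (0 or n − 1), and the only such pair, a_0 b_{k−1}, is no edge either.  These are
-- inequalities between natural numbers, so they hold in every ordered field.

open import Defs

module LabelArithmetic where

  open import Data.Nat as ℕ
    using (ℕ; zero; suc; _+_; _*_; _≤_; _<_; z≤n; s≤s; compare; less; equal; greater)
  import Data.Nat.Properties as ℕₚ
  open import Data.Nat.Tactic.RingSolver using (solve-∀)
  open import Data.Product using (_×_; _,_; ∃)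
  open import Data.Sum using (_⊎_; inj₁; inj₂)
  open import Data.Empty using (⊥; ⊥-elim)
  open import Relation.Binary.PropositionalEquality
  open import Algebra.Properties.CommutativeSemigroup ℕₚ.+-commutativeSemigroup using (interchange)

  record Coeffs : Set where
    constructor ⟨_,_,_⟩
    field
      xCoeff yCoeff const : ℕ

  -- the value of (x , y) ↦ a x + b y + c at the point (s , s²) of the parabola
  _at_ : Coeffs → ℕ → ℕ
  ⟨ a , b , c ⟩ at s = a * s + b * (s * s) + c

  record HalfPlane : Set where
    constructor _≤ᴴ_
    field
      lhs rhs : Coeffs

  open HalfPlane public

  -- the midpoint of the parabola points at s and t lies in H, resp. on its boundary line
  -- (both sides are doubled so that no division occurs)
  Contains : HalfPlane → ℕ → ℕ → Set
  Contains H s t = lhs H at s + lhs H at t ≤ rhs H at s + rhs H at t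

  OnBoundary : HalfPlane → ℕ → ℕ → Set
  OnBoundary H s t = lhs H at s + lhs H at t ≡ rhs H at s + rhs H at t

  Contains-sym : ∀ H {s t} → Contains H s t → Contains H t s
  Contains-sym H {s} {t} = subst₂ _≤_ (ℕₚ.+-comm (lhs H at s) _) (ℕₚ.+-comm (rhs H at s) _)

  OnBoundary-sym : ∀ H {s t} → OnBoundary H s t → OnBoundary H t s
  OnBoundary-sym H {s} {t} = subst₂ _≡_ (ℕₚ.+-comm (lhs H at s) _) (ℕₚ.+-comm (rhs H at s) _)

  private
    slacks-add-up : ∀ H {s t c e f} →
      lhs H at s + e ≡ rhs H at s + c → lhs H at t + f ≡ rhs H at t + c →
      (lhs H at s + lhs H at t) + (e + f) ≡ (rhs H at s + rhs H at t) + (c + c)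
    slacks-add-up H {s} {t} {c} {e} {f} es et = begin
      (x₁ + y₁) + (e + f)   ≡⟨ interchange x₁ y₁ e f ⟩
      (x₁ + e) + (y₁ + f)   ≡⟨ cong₂ _+_ es et ⟩
      (x₂ + c) + (y₂ + c)   ≡⟨ interchange x₂ y₂ c c ⟨
      (x₂ + y₂) + (c + c)   ∎
      where
      open ≡-Reasoning
      x₁ = lhs H at s ; y₁ = lhs H at t ; x₂ = rhs H at s ; y₂ = rhs H at t

  Contains-from-slacks : ∀ H {s t c e f} →
    lhs H at s + e ≡ rhs H at s + c → lhs H at t + f ≡ rhs H at t + c → c + c ≤ e + f →
    Contains H s t
  Contains-from-slacks H {s} {t} {c} {e} {f} es et c+c≤e+f =
    ℕₚ.+-cancelʳ-≤ (c + c) _ _ (ℕₚ.≤-trans (ℕₚ.+-monoʳ-≤ (lhs H at s + lhs H at t) c+c≤e+f)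
                                            (ℕₚ.≤-reflexive (slacks-add-up H es et)))

  OnBoundary-from-slacks : ∀ H {s t c e f} →
    lhs H at s + e ≡ rhs H at s + c → lhs H at t + f ≡ rhs H at t + c → c + c ≡ e + f →
    OnBoundary H s t
  OnBoundary-from-slacks H {s} {t} {c} {e} {f} es et c+c≡e+f =
    ℕₚ.+-cancelʳ-≡ (c + c) _ _ (trans (cong (lhs H at s + lhs H at t +_) c+c≡e+f) (slacks-add-up H es et))

  -- g is the distance from s to the pair {p , p + 1}
  data Offset (p s : ℕ) : ℕ → Set where
    left  : ∀ {g} → s + g ≡ p → Offset p s g
    right : ∀ {g} → suc p + g ≡ s → Offset p s g

  offset : ∀ p s → ∃ (Offset p s)
  offset p s with compare s p
  ... | less .s g    = suc g , left (ℕₚ.+-suc s g)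
  ... | equal .s     = 0 , left (ℕₚ.+-identityʳ s)
  ... | greater .p g = g , right refl

  offset-zero : ∀ {p s} → Offset p s 0 → s ≡ p ⊎ s ≡ suc p
  offset-zero (left e)  = inj₁ (trans (sym (ℕₚ.+-identityʳ _)) e)
  offset-zero (right e) = inj₂ (trans (sym e) (ℕₚ.+-identityʳ _))

  odd² : ℕ → ℕ
  odd² g = suc (2 * g) * suc (2 * g)

  -- With u = 2p + 1, rhs at s + 5 = lhs at s + (2s − u)², and 2s − u = ±(2g + 1) for s at
  -- offset g from {p, p + 1}.
  lowerHalfPlane : ℕ → HalfPlane
  lowerHalfPlane p = ⟨ 4 * u , 0 , 5 ⟩ ≤ᴴ ⟨ 0 , 4 , u * u ⟩
    where u = p + suc p

  private
    lower-slack-left : ∀ s g →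
      4 * ((s + g) + suc (s + g)) * s + 0 * (s * s) + 5 + suc (2 * g) * suc (2 * g)
        ≡ 0 * s + 4 * (s * s) + ((s + g) + suc (s + g)) * ((s + g) + suc (s + g)) + 5
    lower-slack-left = solve-∀

    lower-slack-right : ∀ p g →
      4 * (p + suc p) * (suc p + g) + 0 * ((suc p + g) * (suc p + g)) + 5 + suc (2 * g) * suc (2 * g)
        ≡ 0 * (suc p + g) + 4 * ((suc p + g) * (suc p + g)) + (p + suc p) * (p + suc p) + 5
    lower-slack-right = solve-∀

  lower-slack : ∀ {p s g} → Offset p s g →
                lhs (lowerHalfPlane p) at s + odd² g ≡ rhs (lowerHalfPlane p) at s + 5
  lower-slack {s = s} {g} (left refl)  = lower-slack-left s g
  lower-slack {p} {g = g} (right refl) = lower-slack-right p g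

  9≤odd² : ∀ {g} → 0 < g → 9 ≤ odd² g
  9≤odd² {suc g} _ = ℕₚ.*-mono-≤ 3≤ 3≤
    where
    3≤ : 3 ≤ suc (2 * suc g)
    3≤ = s≤s (ℕₚ.*-monoʳ-≤ 2 (s≤s z≤n))

  lower-contains : ∀ {p s t g h} → Offset p s g → Offset p t h → 0 < g ⊎ 0 < h →
                   Contains (lowerHalfPlane p) s t
  lower-contains {p} {g = g} {h} os ot positive =
    Contains-from-slacks (lowerHalfPlane p) (lower-slack os) (lower-slack ot) (10≤ positive)
    where
    10≤ : 0 < g ⊎ 0 < h → 5 + 5 ≤ odd² g + odd² h
    10≤ (inj₁ 0<g) = ℕₚ.+-mono-≤ (9≤odd² 0<g) (s≤s z≤n)
    10≤ (inj₂ 0<h) = ℕₚ.+-mono-≤ {1} (s≤s z≤n) (9≤odd² 0<h)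

  lower-onBoundary : ∀ {p s t g h} → Offset p s g → Offset p t h → 5 + 5 ≡ odd² g + odd² h →
                     OnBoundary (lowerHalfPlane p) s t
  lower-onBoundary {p} os ot = OnBoundary-from-slacks (lowerHalfPlane p) (lower-slack os) (lower-slack ot)

  -- For a label s = n − 1 − g, rhs at s + n = lhs at s + 2 (s g + 1), and s g ≥ n − 2 unless s is
  -- one of the extreme labels 0 and n − 1.
  upperHalfPlane : ℕ → HalfPlane
  upperHalfPlane n = ⟨ 2 , 2 , n ⟩ ≤ᴴ ⟨ 2 * n , 0 , 2 ⟩

  private
    upper-slack-identity : ∀ s g →
      2 * s + 2 * (s * s) + (suc s + g) + 2 * suc (s * g)
        ≡ 2 * (suc s + g) * s + 0 * (s * s) + 2 + (suc s + g)
    upper-slack-identity = solve-∀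

    upper-interior-identity : ∀ s g →
      2 * suc (suc s * suc g) + 2 ≡ (suc (suc s) + suc g) + (suc (suc s) + suc g) + 2 * (s * g)
    upper-interior-identity = solve-∀

  upper-slack : ∀ {n s g} → suc s + g ≡ n →
                lhs (upperHalfPlane n) at s + 2 * suc (s * g) ≡ rhs (upperHalfPlane n) at s + n
  upper-slack {s = s} {g} refl = upper-slack-identity s g

  upper-contains : ∀ {n s g t h} → suc s + g ≡ n → suc t + h ≡ n → 0 < s → 0 < g →
                   Contains (upperHalfPlane n) s t
  upper-contains {n} {suc s} {suc g} {t} {h} es et _ _ =
    Contains-from-slacks (upperHalfPlane n) (upper-slack es) (upper-slack et) (begin
      n + n                         ≤⟨ ℕₚ.m≤m+n (n + n) (2 * (s * g)) ⟩
      n + n + 2 * (s * g)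
        ≡⟨ subst (λ n → _ ≡ n + n + 2 * (s * g)) es (upper-interior-identity s g) ⟨
      2 * suc (suc s * suc g) + 2
        ≤⟨ ℕₚ.+-monoʳ-≤ (2 * suc (suc s * suc g)) (ℕₚ.*-monoʳ-≤ 2 (s≤s z≤n)) ⟩
      2 * suc (suc s * suc g) + 2 * suc (t * h) ∎)
    where open ℕₚ.≤-Reasoning

  upper-onBoundary : ∀ {n s g t h} → suc s + g ≡ n → suc t + h ≡ n →
                     n + n ≡ 2 * suc (s * g) + 2 * suc (t * h) → OnBoundary (upperHalfPlane n) s t
  upper-onBoundary {n} es et = OnBoundary-from-slacks (upperHalfPlane n) (upper-slack es) (upper-slack et)

  Interior : ℕ → ℕ → Set
  Interior n s = 0 < s × suc s < n

  upper-contains-interior : ∀ {n s t} → Interior n s → t < n → Contains (upperHalfPlane n) s t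
  upper-contains-interior {s = s} (0<s , s+1<n) t<n
    with ℕₚ.m≤n⇒∃[o]m+o≡n s+1<n | ℕₚ.m≤n⇒∃[o]m+o≡n t<n
  ... | g , es | _ , et = upper-contains (trans (ℕₚ.+-suc (suc s) g) es) et 0<s (s≤s z≤n)

  -- Labels of the prism: a_i ↦ 2i and b_i ↦ 2i + 1; each edge is listed with its smaller label first.
  data PrismEdge (k : ℕ) : ℕ → ℕ → Set where
    rung    : ∀ {i} → i < k     → PrismEdge k (2 * i) (suc (2 * i))
    a-edge  : ∀ {i} → suc i < k → PrismEdge k (2 * i) (2 * suc i)
    b-edge  : ∀ {i} → suc i < k → PrismEdge k (suc (2 * i)) (suc (2 * suc i))
    a-close : ∀ {j} → suc (suc j) ≡ k → PrismEdge k 0 (2 * suc j)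
    b-close : ∀ {j} → suc (suc j) ≡ k → PrismEdge k 1 (suc (2 * suc j))

  module _ {k : ℕ} where

    odd-< : ∀ {i} → i < k → suc (2 * i) < 2 * k
    odd-< {i} i<k = subst (_≤ 2 * k) (ℕₚ.*-suc 2 i) (ℕₚ.*-monoʳ-≤ 2 i<k)

    PrismEdge-< : ∀ {s t} → PrismEdge k s t → s < t
    PrismEdge-< (rung _)    = ℕₚ.n<1+n _
    PrismEdge-< (a-edge _)  = ℕₚ.*-monoʳ-< 2 (ℕₚ.n<1+n _)
    PrismEdge-< (b-edge _)  = s≤s (ℕₚ.*-monoʳ-< 2 (ℕₚ.n<1+n _))
    PrismEdge-< (a-close _) = s≤s z≤n
    PrismEdge-< (b-close _) = s≤s (s≤s z≤n)

    PrismEdge-bounded : ∀ {s t} → PrismEdge k s t → t < 2 * k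
    PrismEdge-bounded (rung i<k)    = odd-< i<k
    PrismEdge-bounded (a-edge i<k)  = ℕₚ.*-monoʳ-< 2 i<k
    PrismEdge-bounded (b-edge i<k)  = odd-< i<k
    PrismEdge-bounded (a-close {j} refl) = ℕₚ.*-monoʳ-< 2 (ℕₚ.n<1+n (suc j))
    PrismEdge-bounded (b-close {j} refl) = odd-< (ℕₚ.n<1+n (suc j))

    PrismEdge-consecutive : ∀ {s t} → PrismEdge k s t → t ≡ suc s → ∃ λ i → s ≡ 2 * i
    PrismEdge-consecutive (rung {i} _)   _ = i , refl
    PrismEdge-consecutive (a-edge {i} _) e = ⊥-elim (ℕₚ.even≢odd (suc i) i e)
    PrismEdge-consecutive (b-edge {i} _) e = ⊥-elim (ℕₚ.even≢odd (suc i) i (ℕₚ.suc-injective e))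
    PrismEdge-consecutive (a-close {j} _) e = ⊥-elim (ℕₚ.even≢odd (suc j) 0 e)
    PrismEdge-consecutive (b-close {j} _) e = ⊥-elim (ℕₚ.even≢odd (suc j) 0 (ℕₚ.suc-injective e))

    private
      2<2*k : 2 ≤ k → 2 < 2 * k
      2<2*k 2≤k = ℕₚ.<⇒≤ (ℕₚ.*-monoʳ-≤ 2 2≤k)

    PrismEdge-interior : 2 ≤ k → ∀ {s t} → PrismEdge k s t → Interior (2 * k) s ⊎ Interior (2 * k) t
    PrismEdge-interior 2≤k (rung {zero} _)     = inj₂ (s≤s z≤n , 2<2*k 2≤k)
    PrismEdge-interior 2≤k (rung {suc i} i<k)  = inj₁ (s≤s z≤n , odd-< i<k)
    PrismEdge-interior 2≤k (a-edge i<k)        = inj₂ (s≤s z≤n , odd-< i<k)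
    PrismEdge-interior 2≤k (b-edge {i} i<k)    =
      inj₁ (s≤s z≤n , subst (_< 2 * k) (ℕₚ.*-suc 2 i) (ℕₚ.*-monoʳ-< 2 i<k))
    PrismEdge-interior 2≤k (a-close {j} refl)  = inj₂ (s≤s z≤n , odd-< (ℕₚ.n<1+n (suc j)))
    PrismEdge-interior 2≤k (b-close refl)      = inj₁ (s≤s z≤n , 2<2*k 2≤k)

    lower-contains-edge : ∀ i {s t} → PrismEdge k s t → Contains (lowerHalfPlane (suc (2 * i))) s t
    lower-contains-edge i {s} {t} e with offset (suc (2 * i)) s | offset (suc (2 * i)) t
    ... | suc _ , os | _     , ot = lower-contains os ot (inj₁ (s≤s z≤n))
    ... | zero  , os | suc _ , ot = lower-contains os ot (inj₂ (s≤s z≤n))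
    ... | zero  , os | zero  , ot = ⊥-elim (straddles (offset-zero os) (offset-zero ot))
      where
      p = suc (2 * i)
      s<t = PrismEdge-< e
      straddles : s ≡ p ⊎ s ≡ suc p → t ≡ p ⊎ t ≡ suc p → ⊥
      straddles (inj₁ s≡p) (inj₁ t≡p) = ℕₚ.<⇒≢ s<t (trans s≡p (sym t≡p))
      straddles (inj₁ s≡p) (inj₂ t≡p+1) with PrismEdge-consecutive e (trans t≡p+1 (cong suc (sym s≡p)))
      ... | j , s≡2j = ℕₚ.even≢odd j i (trans (sym s≡2j) s≡p)
      straddles (inj₂ s≡p+1) (inj₁ t≡p) =
        ℕₚ.<-asym s<t (subst₂ _<_ (sym t≡p) (sym s≡p+1) (ℕₚ.n<1+n p))
      straddles (inj₂ s≡p+1) (inj₂ t≡p+1) = ℕₚ.<⇒≢ s<t (trans s≡p+1 (sym t≡p+1))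

    upper-contains-edge : 2 ≤ k → ∀ {s t} → PrismEdge k s t → Contains (upperHalfPlane (2 * k)) s t
    upper-contains-edge 2≤k e with PrismEdge-interior 2≤k e
    ... | inj₁ interior = upper-contains-interior interior (PrismEdge-bounded e)
    ... | inj₂ interior =
      Contains-sym (upperHalfPlane (2 * k))
        (upper-contains-interior interior (ℕₚ.<-trans (PrismEdge-< e) (PrismEdge-bounded e)))

  private
    a-close-identity : ∀ j →
      2 * suc (suc j) + 2 * suc (suc j) ≡ 2 * suc (0 * suc (2 * suc j)) + 2 * suc (2 * suc j * 1)
    a-close-identity = solve-∀

    b-close-identity : ∀ j →
      2 * suc (suc j) + 2 * suc (suc j) ≡ 2 * suc (1 * (2 * suc j)) + 2 * suc (suc (2 * suc j) * 0)
    b-close-identity = solve-∀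

  rung-onBoundary : ∀ i → OnBoundary (lowerHalfPlane (suc (2 * i))) (2 * i) (suc (2 * i))
  rung-onBoundary i = lower-onBoundary {suc (2 * i)} {2 * i} {suc (2 * i)}
    (left (ℕₚ.+-comm (2 * i) 1)) (left (ℕₚ.+-identityʳ _)) refl

  a-edge-onBoundary : ∀ i → OnBoundary (lowerHalfPlane (suc (2 * i))) (2 * i) (2 * suc i)
  a-edge-onBoundary i = lower-onBoundary {suc (2 * i)} {2 * i} {2 * suc i}
    (left (ℕₚ.+-comm (2 * i) 1)) (right (trans (ℕₚ.+-identityʳ _) (sym (ℕₚ.*-suc 2 i)))) refl

  b-edge-onBoundary : ∀ i → OnBoundary (lowerHalfPlane (suc (2 * i))) (suc (2 * i)) (suc (2 * suc i))
  b-edge-onBoundary i = lower-onBoundary {suc (2 * i)} {suc (2 * i)} {suc (2 * suc i)}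
    (left (ℕₚ.+-identityʳ _)) (right (trans (ℕₚ.+-comm _ 1) (cong suc (sym (ℕₚ.*-suc 2 i))))) refl

  a-close-onBoundary : ∀ j → OnBoundary (upperHalfPlane (2 * suc (suc j))) 0 (2 * suc j)
  a-close-onBoundary j = upper-onBoundary {s = 0} {suc (2 * suc j)} {2 * suc j} {1}
    (sym (ℕₚ.*-suc 2 (suc j))) (trans (ℕₚ.+-comm _ 1) (sym (ℕₚ.*-suc 2 (suc j)))) (a-close-identity j)

  b-close-onBoundary : ∀ j → OnBoundary (upperHalfPlane (2 * suc (suc j))) 1 (suc (2 * suc j))
  b-close-onBoundary j = upper-onBoundary {s = 1} {2 * suc j} {suc (2 * suc j)} {0}
    (sym (ℕₚ.*-suc 2 (suc j))) (trans (ℕₚ.+-identityʳ _) (sym (ℕₚ.*-suc 2 (suc j)))) (b-close-identity j)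

  PrismLink : ℕ → ℕ → ℕ → Set
  PrismLink k s t = PrismEdge k s t ⊎ PrismEdge k t s

  PrismLink-≢ : ∀ {k s t} → PrismLink k s t → s ≢ t
  PrismLink-≢ (inj₁ e) = ℕₚ.<⇒≢ (PrismEdge-< e)
  PrismLink-≢ (inj₂ e) = ℕₚ.>⇒≢ (PrismEdge-< e)

  record SupportingHalfPlane (k s t : ℕ) : Set where
    field
      halfPlane      : HalfPlane
      contains-links : ∀ {s′ t′} → PrismLink k s′ t′ → Contains halfPlane s′ t′
      onBoundary     : OnBoundary halfPlane s t
      slopes-differ  : Coeffs.yCoeff (lhs halfPlane) ≢ Coeffs.yCoeff (rhs halfPlane)

  module _ {k : ℕ} (2≤k : 2 ≤ k) where

    private
      edges⇒links : ∀ H → (∀ {s t} → PrismEdge k s t → Contains H s t) →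
                       ∀ {s t} → PrismLink k s t → Contains H s t
      edges⇒links H contains (inj₁ e) = contains e
      edges⇒links H contains (inj₂ e) = Contains-sym H (contains e)

      lowerSupport : ∀ i {s t} → OnBoundary (lowerHalfPlane (suc (2 * i))) s t → SupportingHalfPlane k s t
      lowerSupport i onBoundary = record
        { halfPlane = lowerHalfPlane (suc (2 * i))
        ; contains-links = edges⇒links (lowerHalfPlane (suc (2 * i))) (lower-contains-edge i)
        ; onBoundary = onBoundary ; slopes-differ = λ () }

      upperSupport : ∀ {s t} → OnBoundary (upperHalfPlane (2 * k)) s t → SupportingHalfPlane k s t
      upperSupport onBoundary = record
        { halfPlane = upperHalfPlane (2 * k)
        ; contains-links = edges⇒links (upperHalfPlane (2 * k)) (upper-contains-edge 2≤k)
        ; onBoundary = onBoundary ; slopes-differ = λ () }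

      supportingHalfPlane′ : ∀ {s t} → PrismEdge k s t → SupportingHalfPlane k s t
      supportingHalfPlane′ (rung {i} _)       = lowerSupport i (rung-onBoundary i)
      supportingHalfPlane′ (a-edge {i} _)     = lowerSupport i (a-edge-onBoundary i)
      supportingHalfPlane′ (b-edge {i} _)     = lowerSupport i (b-edge-onBoundary i)
      supportingHalfPlane′ (a-close {j} refl) = upperSupport (a-close-onBoundary j)
      supportingHalfPlane′ (b-close {j} refl) = upperSupport (b-close-onBoundary j)

    supportingHalfPlane : ∀ {s t} → PrismLink k s t → SupportingHalfPlane k s t
    supportingHalfPlane (inj₁ e) = supportingHalfPlane′ e
    supportingHalfPlane (inj₂ e) = record
      { halfPlane = halfPlane ; contains-links = contains-links
      ; onBoundary = OnBoundary-sym halfPlane onBoundary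
      ; slopes-differ = slopes-differ }
      where open SupportingHalfPlane (supportingHalfPlane′ e)

  private
    crossing-identity : ∀ s e t′ →
      s * s + (suc e + t′) * (suc e + t′) + 2 * suc e * s
        ≡ suc (s + e) * suc (s + e) + t′ * t′ + 2 * suc e * t′
    crossing-identity = solve-∀

    crossed : ∀ {s e t t′} → s + t ≡ suc (s + e) + t′ →
              s * s + t * t ≡ suc (s + e) * suc (s + e) + t′ * t′ → s ≡ t′ × t ≡ suc (s + e)
    crossed {s} {e} {t} {t′} sums squares = s≡t′ , t≡s′
      where
      t≡ : t ≡ suc e + t′
      t≡ = ℕₚ.+-cancelˡ-≡ s t (suc e + t′)
             (trans sums (trans (cong suc (ℕₚ.+-assoc s e t′)) (sym (ℕₚ.+-suc s (e + t′)))))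
      B = suc (s + e) * suc (s + e) + t′ * t′
      balanced : B + 2 * suc e * s ≡ B + 2 * suc e * t′
      balanced = begin
        B + 2 * suc e * s                                     ≡⟨ cong (_+ 2 * suc e * s) squares ⟨
        s * s + t * t + 2 * suc e * s                         ≡⟨ cong (λ x → s * s + x * x + 2 * suc e * s) t≡ ⟩
        s * s + (suc e + t′) * (suc e + t′) + 2 * suc e * s   ≡⟨ crossing-identity s e t′ ⟩
        B + 2 * suc e * t′                                    ∎
        where open ≡-Reasoning
      s≡t′ : s ≡ t′
      s≡t′ = ℕₚ.*-cancelˡ-≡ s t′ (2 * suc e) (ℕₚ.+-cancelˡ-≡ B _ _ balanced)
      t≡s′ : t ≡ suc (s + e)
      t≡s′ = trans t≡ (cong suc (trans (cong (e +_) (sym s≡t′)) (ℕₚ.+-comm e s)))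

  sum-sumOfSquares-injective : ∀ {s t s′ t′} → s + t ≡ s′ + t′ → s * s + t * t ≡ s′ * s′ + t′ * t′ →
                               (s ≡ s′ × t ≡ t′) ⊎ (s ≡ t′ × t ≡ s′)
  sum-sumOfSquares-injective {s} {t} {s′} {t′} sums squares with compare s s′
  ... | less .s _     = inj₂ (crossed sums squares)
  ... | equal .s      = inj₁ (refl , ℕₚ.+-cancelˡ-≡ s t t′ sums)
  ... | greater .s′ _ with crossed (sym sums) (sym squares)
  ...   | s′≡t , t′≡s = inj₂ (sym t′≡s , sym s′≡t)

  private
    tangent-gap : ∀ s d → 2 * suc (s + d) * s + 0 * (s * s) + 1 + (d * d + 2 * d)
                          ≡ 0 * s + 1 * (s * s) + suc (s + d) * suc (s + d)
    tangent-gap = solve-∀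

    tangent-gap′ : ∀ v d → 2 * v * suc (v + d) + 0 * (suc (v + d) * suc (v + d)) + 1 + (d * d + 2 * d)
                           ≡ 0 * suc (v + d) + 1 * (suc (v + d) * suc (v + d)) + v * v
    tangent-gap′ = solve-∀

    tangent-touch : ∀ v → 2 * v * v + 0 * (v * v) + 1 ≡ suc (0 * v + 1 * (v * v) + v * v)
    tangent-touch = solve-∀

  -- The tangent at v raised by 1: it has every parabola point at a natural s ≠ v on or above it,
  -- as (s − v)² ≥ 1, but not the point at v.
  tangentHalfPlane : ℕ → HalfPlane
  tangentHalfPlane v = ⟨ 2 * v , 0 , 1 ⟩ ≤ᴴ ⟨ 0 , 1 , v * v ⟩

  tangent-below : ∀ {v s} → s ≢ v → lhs (tangentHalfPlane v) at s ≤ rhs (tangentHalfPlane v) at s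
  tangent-below {v} {s} s≢v with compare s v
  ... | less .s d    = ℕₚ.≤-trans (ℕₚ.m≤m+n _ (d * d + 2 * d)) (ℕₚ.≤-reflexive (tangent-gap s d))
  ... | equal .s     = ⊥-elim (s≢v refl)
  ... | greater .v d = ℕₚ.≤-trans (ℕₚ.m≤m+n _ (d * d + 2 * d)) (ℕₚ.≤-reflexive (tangent-gap′ v d))

  tangent-above : ∀ v → rhs (tangentHalfPlane v) at v < lhs (tangentHalfPlane v) at v
  tangent-above v = ℕₚ.≤-reflexive (sym (tangent-touch v))

module PrismGraph where

  open import Data.Nat as ℕ using (ℕ; zero; suc; _+_; _*_; _≤_; _<_; z≤n; s≤s)
  import Data.Nat.Properties as ℕₚ
  open import Data.Fin using (Fin; zero; suc; toℕ; fromℕ; fromℕ<; inject₁; splitAt; join)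
  open import Data.Fin.Properties
    using (toℕ-injective; toℕ<n; toℕ-fromℕ; toℕ-fromℕ<; toℕ-inject₁; splitAt-join; join-splitAt)
  open import Data.Product using (_×_; _,_; ∃; Σ)
  open import Data.Sum using (_⊎_; inj₁; inj₂; swap)
  open import Data.Sum.Properties using (swap-involutive)
  open import Function using (_∘′_)
  open import Data.Empty using (⊥-elim)
  open import Relation.Nullary using (¬_; yes; no)
  open import Relation.Binary.PropositionalEquality

  Next : (k : ℕ) → Fin k → Fin k → Set
  Next k i j = suc (toℕ i) ≡ toℕ j ⊎ (suc (toℕ i) ≡ k × toℕ j ≡ 0)

  module _ {k : ℕ} where

    CycleAdj⇒Next : ∀ {i j} → CycleAdj k i j → Next k i j ⊎ Next k j i
    CycleAdj⇒Next (inj₁ e)                      = inj₁ (inj₁ e)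
    CycleAdj⇒Next (inj₂ (inj₁ e))               = inj₂ (inj₁ e)
    CycleAdj⇒Next (inj₂ (inj₂ (inj₁ (i≡0 , e)))) = inj₂ (inj₂ (e , i≡0))
    CycleAdj⇒Next (inj₂ (inj₂ (inj₂ (j≡0 , e)))) = inj₁ (inj₂ (e , j≡0))

    Next⇒CycleAdj : ∀ {i j} → Next k i j → CycleAdj k i j
    Next⇒CycleAdj (inj₁ e)         = inj₁ e
    Next⇒CycleAdj (inj₂ (e , j≡0)) = inj₂ (inj₂ (inj₂ (j≡0 , e)))

    Next⇒CycleAdjᵒ : ∀ {i j} → Next k i j → CycleAdj k j i
    Next⇒CycleAdjᵒ (inj₁ e)         = inj₂ (inj₁ e)
    Next⇒CycleAdjᵒ (inj₂ (e , j≡0)) = inj₂ (inj₂ (inj₁ (j≡0 , e)))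

    CycleAdj-sym : ∀ {i j} → CycleAdj k i j → CycleAdj k j i
    CycleAdj-sym a with CycleAdj⇒Next a
    ... | inj₁ next = Next⇒CycleAdjᵒ next
    ... | inj₂ prev = Next⇒CycleAdj prev

    Next-functional : ∀ {i j j′} → Next k i j → Next k i j′ → j ≡ j′
    Next-functional (inj₁ e) (inj₁ e′)       = toℕ-injective (trans (sym e) e′)
    Next-functional {j = j} (inj₁ e) (inj₂ (e′ , _)) = ⊥-elim (ℕₚ.<-irrefl (trans (sym e) e′) (toℕ<n j))
    Next-functional {j′ = j′} (inj₂ (e , _)) (inj₁ e′) = ⊥-elim (ℕₚ.<-irrefl (trans (sym e′) e) (toℕ<n j′))
    Next-functional (inj₂ (_ , j≡0)) (inj₂ (_ , j′≡0)) = toℕ-injective (trans j≡0 (sym j′≡0))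

    Next-injective : ∀ {i i′ j} → Next k i j → Next k i′ j → i ≡ i′
    Next-injective (inj₁ e) (inj₁ e′)           = toℕ-injective (ℕₚ.suc-injective (trans e (sym e′)))
    Next-injective (inj₁ e) (inj₂ (_ , j≡0))    = ⊥-elim (ℕₚ.1+n≢0 (trans e j≡0))
    Next-injective (inj₂ (_ , j≡0)) (inj₁ e′)   = ⊥-elim (ℕₚ.1+n≢0 (trans e′ j≡0))
    Next-injective (inj₂ (e , _)) (inj₂ (e′ , _)) = toℕ-injective (ℕₚ.suc-injective (trans e (sym e′)))

    Next-irreflexive : 2 ≤ k → ∀ {i} → ¬ Next k i i
    Next-irreflexive _ (inj₁ e) = ℕₚ.1+n≢n e
    Next-irreflexive 2≤k (inj₂ (e , i≡0)) = ℕₚ.<-irrefl (trans (cong suc (sym i≡0)) e) 2≤k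

    Next-asym : 3 ≤ k → ∀ {i j} → Next k i j → ¬ Next k j i
    Next-asym _ {i} (inj₁ e) (inj₁ e′) =
      ℕₚ.<⇒≢ (ℕₚ.m<n⇒m<1+n (ℕₚ.n<1+n (toℕ i))) (sym (trans (cong suc e) e′))
    Next-asym 3≤k (inj₁ e) (inj₂ (e′ , i≡0)) =
      ℕₚ.<-irrefl (trans (cong (λ n → suc (suc n)) (sym i≡0)) (trans (cong suc e) e′)) 3≤k
    Next-asym 3≤k (inj₂ (e , j≡0)) (inj₁ e′) =
      ℕₚ.<-irrefl (trans (cong (λ n → suc (suc n)) (sym j≡0)) (trans (cong suc e′) e)) 3≤k
    Next-asym 3≤k (inj₂ (e , _)) (inj₂ (_ , i≡0)) =
      ℕₚ.<-irrefl (trans (cong suc (sym i≡0)) e) (ℕₚ.≤-trans (ℕₚ.n≤1+n 2) 3≤k)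

    CycleAdj-irreflexive : 2 ≤ k → ∀ {i} → ¬ CycleAdj k i i
    CycleAdj-irreflexive 2≤k a with CycleAdj⇒Next a
    ... | inj₁ next = Next-irreflexive 2≤k next
    ... | inj₂ next = Next-irreflexive 2≤k next

    next : ∀ (i : Fin k) → ∃ (Next k i)
    next i with suc (toℕ i) ℕ.<? k
    ... | yes i+1<k = fromℕ< i+1<k , inj₁ (sym (toℕ-fromℕ< i+1<k))
    ... | no  i+1≮k = fromℕ< 0<k , inj₂ (ℕₚ.≤-antisym (toℕ<n i) (ℕₚ.≮⇒≥ i+1≮k) , toℕ-fromℕ< 0<k)
      where 0<k = ℕₚ.<-≤-trans (s≤s z≤n) (toℕ<n i)

  prev : ∀ {k} (j : Fin k) → ∃ λ i → Next k i j
  prev {suc m} zero    = fromℕ m , inj₂ (cong suc (toℕ-fromℕ m) , refl)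
  prev {suc m} (suc j) = inject₁ j , inj₁ (cong suc (toℕ-inject₁ j))

  ThreeNeighbours : {A : Set} → (A → A → Set) → A → Set
  ThreeNeighbours {A} Adj v =
    Σ A λ a → Σ A λ b → Σ A λ c →
      (a ≢ b) × (a ≢ c) × (b ≢ c) × Adj v a × Adj v b × Adj v c ×
      (∀ u → Adj v u → (u ≡ a) ⊎ (u ≡ b) ⊎ (u ≡ c))

  ThreeNeighbours-transport :
    ∀ {A B : Set} {_~_ : A → A → Set} {_≈_ : B → B → Set} (f : A → B) (g : B → A) →
    (∀ x → g (f x) ≡ x) → (∀ y → f (g y) ≡ y) →
    (∀ {x y} → x ~ y → f x ≈ f y) → (∀ {x y} → f x ≈ f y → x ~ y) →
    ∀ {x} → ThreeNeighbours _~_ x → ThreeNeighbours _≈_ (f x)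
  ThreeNeighbours-transport {_≈_ = _≈_} f g gf fg preserve reflect {x}
    (a , b , c , a≢b , a≢c , b≢c , x~a , x~b , x~c , only) =
    f a , f b , f c , a≢b ∘′ injective , a≢c ∘′ injective , b≢c ∘′ injective ,
    preserve x~a , preserve x~b , preserve x~c , only′
    where
    injective : ∀ {x y} → f x ≡ f y → x ≡ y
    injective {x} {y} e = trans (sym (gf x)) (trans (cong g e) (gf y))
    only′ : ∀ u → f x ≈ u → (u ≡ f a) ⊎ (u ≡ f b) ⊎ (u ≡ f c)
    only′ u fx≈u with only (g u) (reflect (subst (f x ≈_) (sym (fg u)) fx≈u))
    ... | inj₁ e        = inj₁ (trans (sym (fg u)) (cong f e))
    ... | inj₂ (inj₁ e) = inj₂ (inj₁ (trans (sym (fg u)) (cong f e)))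
    ... | inj₂ (inj₂ e) = inj₂ (inj₂ (trans (sym (fg u)) (cong f e)))

  module _ {k : ℕ} where

    PrismAdj′-sym : ∀ {x y} → PrismAdj′ k x y → PrismAdj′ k y x
    PrismAdj′-sym {inj₁ _} {inj₁ _} a = CycleAdj-sym a
    PrismAdj′-sym {inj₂ _} {inj₂ _} a = CycleAdj-sym a
    PrismAdj′-sym {inj₁ _} {inj₂ _} a = sym a
    PrismAdj′-sym {inj₂ _} {inj₁ _} a = sym a

    PrismAdj′-irreflexive : 2 ≤ k → ∀ {x} → ¬ PrismAdj′ k x x
    PrismAdj′-irreflexive 2≤k {inj₁ _} = CycleAdj-irreflexive 2≤k
    PrismAdj′-irreflexive 2≤k {inj₂ _} = CycleAdj-irreflexive 2≤k

    PrismAdj′-swap : ∀ {x y} → PrismAdj′ k x y → PrismAdj′ k (swap x) (swap y)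
    PrismAdj′-swap {inj₁ _} {inj₁ _} a = a
    PrismAdj′-swap {inj₂ _} {inj₂ _} a = a
    PrismAdj′-swap {inj₁ _} {inj₂ _} a = a
    PrismAdj′-swap {inj₂ _} {inj₁ _} a = a

    a-threeNeighbours : 3 ≤ k → ∀ i → ThreeNeighbours (PrismAdj′ k) (inj₁ i)
    a-threeNeighbours 3≤k i with next i | prev i
    ... | n , i→n | p , p→i =
      inj₁ n , inj₁ p , inj₂ i ,
      (λ { refl → Next-asym 3≤k i→n p→i }) , (λ ()) , (λ ()) ,
      Next⇒CycleAdj i→n , Next⇒CycleAdjᵒ p→i , refl , only
      where
      only : ∀ y → PrismAdj′ k (inj₁ i) y → (y ≡ inj₁ n) ⊎ (y ≡ inj₁ p) ⊎ (y ≡ inj₂ i)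
      only (inj₁ j) a with CycleAdj⇒Next a
      ... | inj₁ i→j = inj₁ (cong inj₁ (Next-functional i→j i→n))
      ... | inj₂ j→i = inj₂ (inj₁ (cong inj₁ (Next-injective j→i p→i)))
      only (inj₂ j) refl = inj₂ (inj₂ refl)

    PrismAdj′-threeNeighbours : 3 ≤ k → ∀ x → ThreeNeighbours (PrismAdj′ k) x
    PrismAdj′-threeNeighbours 3≤k (inj₁ i) = a-threeNeighbours 3≤k i
    PrismAdj′-threeNeighbours 3≤k (inj₂ i) =
      ThreeNeighbours-transport {_~_ = PrismAdj′ k} {PrismAdj′ k} swap swap swap-involutive swap-involutive
        PrismAdj′-swap (λ {x} {y} a → subst₂ (PrismAdj′ k) (swap-involutive x) (swap-involutive y) (PrismAdj′-swap a))
        (a-threeNeighbours 3≤k i)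

    prism : 2 ≤ k → SimpleGraph (k + k)
    prism 2≤k = record
      { Adj = PrismAdj k ; sym = PrismAdj′-sym ; irrefl = PrismAdj′-irreflexive 2≤k }

    prism-threeRegular : (2≤k : 2 ≤ k) → 3 ≤ k → ThreeRegular (prism 2≤k)
    prism-threeRegular _ 3≤k v =
      subst (Degree3 (PrismAdj k)) (join-splitAt k k v)
        (ThreeNeighbours-transport {_~_ = PrismAdj′ k} {PrismAdj k} (join k k) (splitAt k)
          (splitAt-join k k) (join-splitAt k k)
          (λ {x} {y} → subst₂ (PrismAdj′ k) (sym (splitAt-join k k x)) (sym (splitAt-join k k y)))
          (λ {x} {y} → subst₂ (PrismAdj′ k) (splitAt-join k k x) (splitAt-join k k y))
          (PrismAdj′-threeNeighbours 3≤k (splitAt k v)))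

  module Labelling {k : ℕ} (2≤k : 2 ≤ k) where
    open LabelArithmetic using (PrismEdge; rung; a-edge; b-edge; a-close; b-close; PrismLink)

    label′ : Fin k ⊎ Fin k → ℕ
    label′ (inj₁ i) = 2 * toℕ i
    label′ (inj₂ i) = suc (2 * toℕ i)

    label′-injective : ∀ {x y} → label′ x ≡ label′ y → x ≡ y
    label′-injective {inj₁ i} {inj₁ j} e = cong inj₁ (toℕ-injective (ℕₚ.*-cancelˡ-≡ (toℕ i) (toℕ j) 2 e))
    label′-injective {inj₁ i} {inj₂ j} e = ⊥-elim (ℕₚ.even≢odd (toℕ i) (toℕ j) e)
    label′-injective {inj₂ i} {inj₁ j} e = ⊥-elim (ℕₚ.even≢odd (toℕ j) (toℕ i) (sym e))
    label′-injective {inj₂ i} {inj₂ j} e =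
      cong inj₂ (toℕ-injective (ℕₚ.*-cancelˡ-≡ (toℕ i) (toℕ j) 2 (ℕₚ.suc-injective e)))

    label : Fin (k + k) → ℕ
    label u = label′ (splitAt k u)

    label-injective : ∀ {u v} → label u ≡ label v → u ≡ v
    label-injective {u} {v} e = begin
      u                      ≡⟨ join-splitAt k k u ⟨
      join k k (splitAt k u) ≡⟨ cong (join k k) (label′-injective {splitAt k u} {splitAt k v} e) ⟩
      join k k (splitAt k v) ≡⟨ join-splitAt k k v ⟩
      v                      ∎
      where open ≡-Reasoning

    private
      a-wrap : ∀ {m} → suc m ≡ k → PrismEdge k 0 (2 * m)
      a-wrap {zero}  1≡k = ⊥-elim (ℕₚ.<-irrefl 1≡k 2≤k)
      a-wrap {suc m} e   = a-close e

      b-wrap : ∀ {m} → suc m ≡ k → PrismEdge k 1 (suc (2 * m))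
      b-wrap {zero}  1≡k = ⊥-elim (ℕₚ.<-irrefl 1≡k 2≤k)
      b-wrap {suc m} e   = b-close e

      a-link : ∀ {i j} → Next k i j → PrismLink k (label′ (inj₁ i)) (label′ (inj₁ j))
      a-link {i} {j} (inj₁ e) = inj₁ (subst (λ n → PrismEdge k (2 * toℕ i) (2 * n)) e
                                          (a-edge (subst (_< k) (sym e) (toℕ<n j))))
      a-link {i} (inj₂ (e , j≡0)) = inj₂ (subst (λ n → PrismEdge k (2 * n) (2 * toℕ i)) (sym j≡0) (a-wrap e))

      b-link : ∀ {i j} → Next k i j → PrismLink k (label′ (inj₂ i)) (label′ (inj₂ j))
      b-link {i} {j} (inj₁ e) = inj₁ (subst (λ n → PrismEdge k (suc (2 * toℕ i)) (suc (2 * n))) e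
                                          (b-edge (subst (_< k) (sym e) (toℕ<n j))))
      b-link {i} (inj₂ (e , j≡0)) =
        inj₂ (subst (λ n → PrismEdge k (suc (2 * n)) (suc (2 * toℕ i))) (sym j≡0) (b-wrap e))

    label′-link : ∀ {x y} → PrismAdj′ k x y → PrismLink k (label′ x) (label′ y)
    label′-link {inj₁ i} {inj₁ j} a with CycleAdj⇒Next a
    ... | inj₁ i→j = a-link i→j
    ... | inj₂ j→i = swap (a-link j→i)
    label′-link {inj₂ i} {inj₂ j} a with CycleAdj⇒Next a
    ... | inj₁ i→j = b-link i→j
    ... | inj₂ j→i = swap (b-link j→i)
    label′-link {inj₁ i} {inj₂ .i} refl = inj₁ (rung (toℕ<n i))
    label′-link {inj₂ i} {inj₁ .i} refl = inj₂ (rung (toℕ<n i))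

    label-link : ∀ {u v} → PrismAdj k u v → PrismLink k (label u) (label v)
    label-link = label′-link

module OrderedFieldGeometry (R : RealClosedField) where

  open LabelArithmetic using (Coeffs; ⟨_,_,_⟩; _at_; HalfPlane; lhs; rhs; Contains; OnBoundary;
                           sum-sumOfSquares-injective; tangentHalfPlane; tangent-below; tangent-above)
  open import Data.Nat as ℕ using (ℕ; suc)
  import Data.Nat.Properties as ℕₚ
  open import Data.List using (List; []; _∷_)
  open import Data.Maybe using (Maybe; just; nothing)
  open import Data.Product using (_×_; _,_; proj₁; proj₂; Σ)
  open import Data.Sum using (_⊎_; inj₁; inj₂)
  open import Data.Empty using (⊥-elim)
  open import Function using (_∘_)
  open import Relation.Nullary using (¬_; yes; no)
  open import Relation.Binary.Definitions using (tri<; tri≈; tri>)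
  open import Relation.Binary.Structures using (IsStrictTotalOrder)
  open import Relation.Binary.PropositionalEquality
  open import Algebra.Bundles using (CommutativeRing; CommutativeSemiring)
  import Algebra.Properties.Ring as RingProperties
  import Algebra.Properties.Semiring.Mult as SemiringMultiplication
  import Algebra.Solver.Ring.NaturalCoefficients as NaturalCoefficients
  import Relation.Binary.Construct.StrictToNonStrict as StrictToNonStrict
  import Relation.Binary.Reasoning.StrictPartialOrder as StrictPartialOrderReasoning
  open import Relation.Binary.Bundles using (StrictPartialOrder)

  open RealClosedField R
  -- Defs declares no fixity for _≤_, which would make a + b ≤ c + d parse as a + (b ≤ c) + d.
  open Geometry R renaming (_≤_ to infix 4 _≤_)
  open IsStrictTotalOrder isStrictTotalOrder using (compare; <-respˡ-≈)
    renaming (trans to <-trans; irrefl to <-irrefl′)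

  commutativeRing : CommutativeRing _ _
  commutativeRing = record { isCommutativeRing = isCommutativeRing }

  strictPartialOrder : StrictPartialOrder _ _ _
  strictPartialOrder = record
    { isStrictPartialOrder = IsStrictTotalOrder.isStrictPartialOrder isStrictTotalOrder }

  module <-Reasoning = StrictPartialOrderReasoning strictPartialOrder

  commutativeSemiring : CommutativeSemiring _ _
  commutativeSemiring = CommutativeRing.commutativeSemiring commutativeRing

  open CommutativeRing commutativeRing
    using ( +-comm; +-assoc; *-comm; *-assoc; +-identityˡ; +-identityʳ; *-identityˡ; *-identityʳ
          ; zeroˡ; distribˡ; distribʳ; -‿inverseˡ; -‿inverseʳ; ring; semiring)
  open RingProperties ring using (-‿distribˡ-*; -‿distribʳ-*; -‿involutive)
  open SemiringMultiplication semiring using (×-homo-+; ×1-homo-*) renaming (_×_ to _×ₙ_)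

  private
    decideℕ : ∀ m n → Maybe (m ×ₙ 1# ≡ n ×ₙ 1#)
    decideℕ m n with m ℕ.≟ n
    ... | yes refl = just refl
    ... | no _     = nothing

  module Solver = NaturalCoefficients commutativeSemiring decideℕ
  open Solver using (solve; _:+_; _:*_; _:=_; con)

  <-irrefl : ∀ {x} → ¬ (x < x)
  <-irrefl = <-irrefl′ refl

  ≤-<-trans : ∀ {x y z} → x ≤ y → y < z → x < z
  ≤-<-trans = StrictToNonStrict.≤-<-trans _≡_ _<_ sym <-trans <-respˡ-≈

  ≤⇒≯ : ∀ {x y} → x ≤ y → ¬ (y < x)
  ≤⇒≯ x≤y y<x = <-irrefl (≤-<-trans x≤y y<x)

  +-monoˡ-< : ∀ {x y} z → x < y → z + x < z + y
  +-monoˡ-< {x} {y} z x<y = subst₂ _<_ (+-comm x z) (+-comm y z) (+-mono-< z x<y)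

  +-mono-≤ : ∀ {a b c d} → a ≤ b → c ≤ d → a + c ≤ b + d
  +-mono-≤ {a} {b} {c} {d} (inj₁ a<b) (inj₁ c<d) = inj₁ (<-trans (+-mono-< c a<b) (+-monoˡ-< b c<d))
  +-mono-≤ {c = c} (inj₁ a<b) (inj₂ refl) = inj₁ (+-mono-< c a<b)
  +-mono-≤ {a = a} (inj₂ refl) (inj₁ c<d) = inj₁ (+-monoˡ-< a c<d)
  +-mono-≤ (inj₂ refl) (inj₂ refl) = inj₂ refl

  neg-antitone : ∀ {x y} → x < y → - y < - x
  neg-antitone {x} {y} x<y =
    subst₂ _<_ (cancel x y) (trans (cong (y +_) (+-comm (- x) (- y))) (cancel y x)) (+-mono-< (- x + - y) x<y)
    where
    cancel : ∀ a b → a + (- a + - b) ≡ - b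
    cancel a b = begin
      a + (- a + - b)  ≡⟨ +-assoc a (- a) (- b) ⟨
      (a + - a) + - b  ≡⟨ cong (_+ - b) (-‿inverseʳ a) ⟩
      0# + - b         ≡⟨ +-identityˡ (- b) ⟩
      - b              ∎
      where open ≡-Reasoning

  neg*neg : ∀ x → (- x) * (- x) ≡ x * x
  neg*neg x = trans (sym (-‿distribˡ-* x (- x))) (trans (cong -_ (sym (-‿distribʳ-* x x))) (-‿involutive (x * x)))

  0<1 : 0# < 1#
  0<1 with compare 0# 1#
  ... | tri< 0<1 _ _ = 0<1
  ... | tri≈ _ 0≡1 _ = ⊥-elim (0≢1 0≡1)
  ... | tri> _ _ 1<0 = ⊥-elim (<-irrefl (<-trans 1<0 0<[-1][-1]))
    where
    0<-1 : 0# < - 1#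
    0<-1 = subst₂ _<_ (-‿inverseʳ 1#) (+-identityˡ (- 1#)) (+-mono-< (- 1#) 1<0)
    0<[-1][-1] : 0# < 1#
    0<[-1][-1] = subst (0# <_) (trans (neg*neg 1#) (*-identityˡ 1#)) (*-pos 0<-1 0<-1)

  *-monoˡ-< : ∀ {w a b} → 0# < w → a < b → w * a < w * b
  *-monoˡ-< {w} {a} {b} 0<w a<b =
    subst₂ _<_ (+-identityʳ (w * a)) w[a+[b-a]]≡wb (+-monoˡ-< (w * a) (*-pos 0<w 0<b-a))
    where
    0<b-a : 0# < b + - a
    0<b-a = subst (_< b + - a) (-‿inverseʳ a) (+-mono-< (- a) a<b)
    w[a+[b-a]]≡wb : w * a + w * (b + - a) ≡ w * b
    w[a+[b-a]]≡wb = begin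
      w * a + w * (b + - a)  ≡⟨ distribˡ w a (b + - a) ⟨
      w * (a + (b + - a))    ≡⟨ cong (w *_) (trans (+-comm a _) (trans (+-assoc b (- a) a)
                                   (trans (cong (b +_) (-‿inverseˡ a)) (+-identityʳ b)))) ⟩
      w * b                  ∎
      where open ≡-Reasoning

  *-monoʳ-< : ∀ {w a b} → 0# < w → a < b → a * w < b * w
  *-monoʳ-< {w} {a} {b} 0<w a<b = subst₂ _<_ (*-comm w a) (*-comm w b) (*-monoˡ-< 0<w a<b)

  *-monoˡ-≤ : ∀ {w a b} → 0# ≤ w → a ≤ b → w * a ≤ w * b
  *-monoˡ-≤ {a = a} {b} (inj₂ refl) _   = inj₂ (trans (zeroˡ a) (sym (zeroˡ b)))
  *-monoˡ-≤ (inj₁ 0<w) (inj₁ a<b)       = inj₁ (*-monoˡ-< 0<w a<b)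
  *-monoˡ-≤ (inj₁ 0<w) (inj₂ refl)      = inj₂ refl

  ι : ℕ → Carrier
  ι n = n ×ₙ 1#

  ι-+ : ∀ m n → ι (m ℕ.+ n) ≡ ι m + ι n
  ι-+ m n = ×-homo-+ 1# m n

  ι-* : ∀ m n → ι (m ℕ.* n) ≡ ι m * ι n
  ι-* = ×1-homo-*

  ι-<-suc : ∀ n → ι n < ι (suc n)
  ι-<-suc n = subst (_< 1# + ι n) (+-identityˡ (ι n)) (+-mono-< (ι n) 0<1)

  ι-mono-< : ∀ {m n} → m ℕ.< n → ι m < ι n
  ι-mono-< {m} {suc n} m<1+n with ℕₚ.m≤n⇒m<n∨m≡n (ℕ.s≤s⁻¹ m<1+n)
  ... | inj₁ m<n  = <-trans (ι-mono-< m<n) (ι-<-suc n)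
  ... | inj₂ refl = ι-<-suc n

  ι-mono-≤ : ∀ {m n} → m ℕ.≤ n → ι m ≤ ι n
  ι-mono-≤ m≤n with ℕₚ.m≤n⇒m<n∨m≡n m≤n
  ... | inj₁ m<n  = inj₁ (ι-mono-< m<n)
  ... | inj₂ refl = inj₂ refl

  ι-injective : ∀ {m n} → ι m ≡ ι n → m ≡ n
  ι-injective {m} {n} ιm≡ιn with ℕₚ.<-cmp m n
  ... | tri< m<n _ _ = ⊥-elim (<-irrefl (subst (_< ι n) ιm≡ιn (ι-mono-< m<n)))
  ... | tri≈ _ m≡n _ = m≡n
  ... | tri> _ _ n<m = ⊥-elim (<-irrefl (subst (ι n <_) ιm≡ιn (ι-mono-< n<m)))

  0<2 : 0# < 1# + 1#
  0<2 = <-trans 0<1 (subst (_< 1# + 1#) (+-identityʳ 1#) (+-monoˡ-< 1# 0<1))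

  half-+ : ∀ x → half * (x + x) ≡ x
  half-+ x = begin
    half * (x + x)           ≡⟨ cong (λ y → half * (y + y)) (*-identityˡ x) ⟨
    half * (1# * x + 1# * x) ≡⟨ cong (half *_) (distribʳ x 1# 1#) ⟨
    half * ((1# + 1#) * x)   ≡⟨ *-assoc half (1# + 1#) x ⟨
    (half * (1# + 1#)) * x   ≡⟨ cong (_* x) (trans (*-comm half _) (inv-correct (1# + 1#) 2≢0)) ⟩
    1# * x                   ≡⟨ *-identityˡ x ⟩
    x                        ∎
    where
    open ≡-Reasoning
    2≢0 : 1# + 1# ≢ 0#
    2≢0 2≡0 = <-irrefl (subst (0# <_) 2≡0 0<2)

  half-double : ∀ x → half * x + half * x ≡ x
  half-double x = trans (sym (distribˡ half x x)) (half-+ x)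

  half-injective : ∀ {x y} → half * x ≡ half * y → x ≡ y
  half-injective {x} {y} e = trans (sym (half-double x)) (trans (cong (λ z → z + z) e) (half-double y))

  0<half : 0# < half
  0<half with compare 0# half
  ... | tri< 0<half _ _ = 0<half
  ... | tri≈ _ 0≡half _ = ⊥-elim (0≢1 (begin
    0#                  ≡⟨ zeroˡ (1# + 1#) ⟨
    0# * (1# + 1#)      ≡⟨ cong (_* (1# + 1#)) 0≡half ⟩
    half * (1# + 1#)    ≡⟨ half-+ 1# ⟩
    1#                  ∎))
    where open ≡-Reasoning
  ... | tri> _ _ half<0 =
    ⊥-elim (<-irrefl (<-trans 0<1 (subst₂ _<_ (half-+ 1#) (zeroˡ (1# + 1#)) (*-monoʳ-< 0<2 half<0))))

  half-< : ∀ {ε} → 0# < ε → half * ε < ε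
  half-< {ε} 0<ε =
    subst₂ _<_ (+-identityʳ (half * ε)) (half-double ε) (+-monoˡ-< (half * ε) (*-pos 0<half 0<ε))

  ⟦_⟧ : Coeffs → Point → Carrier
  ⟦ ⟨ a , b , c ⟩ ⟧ (x , y) = ι a * x + ι b * y + ι c

  _∈ᴴ_ : Point → HalfPlane → Set
  q ∈ᴴ H = ⟦ lhs H ⟧ q ≤ ⟦ rhs H ⟧ q

  sumOver-mono-≤ : ∀ {I : Set} (is : List I) {f g : I → Carrier} → (∀ i → f i ≤ g i) →
                   sumOver is f ≤ sumOver is g
  sumOver-mono-≤ []       _   = inj₂ refl
  sumOver-mono-≤ (i ∷ is) f≤g = +-mono-≤ (f≤g i) (sumOver-mono-≤ is f≤g)

  sumOver-⟦⟧ : ∀ {I : Set} (is : List I) (w : I → Carrier) (p : I → Point) a b c →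
    sumOver is (λ i → w i * ⟦ ⟨ a , b , c ⟩ ⟧ (p i)) ≡
      ι a * sumOver is (λ i → w i * proj₁ (p i)) + ι b * sumOver is (λ i → w i * proj₂ (p i)) +
      ι c * sumOver is w
  sumOver-⟦⟧ [] w p a b c =
    solve 3 (λ A B C → con 0 := A :* con 0 :+ B :* con 0 :+ C :* con 0) refl (ι a) (ι b) (ι c)
  sumOver-⟦⟧ (i ∷ is) w p a b c rewrite sumOver-⟦⟧ is w p a b c =
    solve 9 (λ wᵢ x y A B C X Y W →
               wᵢ :* (A :* x :+ B :* y :+ C) :+ (A :* X :+ B :* Y :+ C :* W)
                 := A :* (wᵢ :* x :+ X) :+ B :* (wᵢ :* y :+ Y) :+ C :* (wᵢ :+ W))
      refl (w i) (proj₁ (p i)) (proj₂ (p i)) (ι a) (ι b) (ι c)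
      (sumOver is (λ i → w i * proj₁ (p i))) (sumOver is (λ i → w i * proj₂ (p i))) (sumOver is w)

  hull-⊆ᴴ : ∀ {I : Set} {is : List I} {S : I → Set} {p : I → Point} {z} H →
            (∀ i → S i → p i ∈ᴴ H) → InConvHull is S p z → z ∈ᴴ H
  hull-⊆ᴴ {is = is} {S} {p} {z} H generators (w , 0≤w , support , Σw≡1 , Σwx≡x , Σwy≡y) =
    subst₂ _≤_ (value (lhs H)) (value (rhs H)) (sumOver-mono-≤ is termwise)
    where
    value : ∀ ℓ → sumOver is (λ i → w i * ⟦ ℓ ⟧ (p i)) ≡ ⟦ ℓ ⟧ z
    value ⟨ a , b , c ⟩ = begin
      sumOver is (λ i → w i * ⟦ ⟨ a , b , c ⟩ ⟧ (p i))
        ≡⟨ sumOver-⟦⟧ is w p a b c ⟩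
      ι a * sumOver is (λ i → w i * proj₁ (p i)) + ι b * sumOver is (λ i → w i * proj₂ (p i)) + ι c * sumOver is w
        ≡⟨ cong₂ (λ x y → ι a * x + ι b * y + ι c * sumOver is w) Σwx≡x Σwy≡y ⟩
      ι a * proj₁ z + ι b * proj₂ z + ι c * sumOver is w
        ≡⟨ cong (λ W → ι a * proj₁ z + ι b * proj₂ z + ι c * W) Σw≡1 ⟩
      ι a * proj₁ z + ι b * proj₂ z + ι c * 1#
        ≡⟨ cong (ι a * proj₁ z + ι b * proj₂ z +_) (*-identityʳ (ι c)) ⟩
      ⟦ ⟨ a , b , c ⟩ ⟧ z ∎
      where open ≡-Reasoning
    termwise : ∀ i → w i * ⟦ lhs H ⟧ (p i) ≤ w i * ⟦ rhs H ⟧ (p i)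
    termwise i with 0≤w i
    ... | inj₁ 0<wᵢ =
      *-monoˡ-≤ (inj₁ 0<wᵢ) (generators i (support i λ wᵢ≡0 → <-irrefl (subst (0# <_) wᵢ≡0 0<wᵢ)))
    ... | inj₂ 0≡wᵢ rewrite sym 0≡wᵢ = inj₂ (trans (zeroˡ _) (sym (zeroˡ _)))

  _↑_ : Point → Carrier → Point
  (x , y) ↑ η = x , y + η

  ⟦⟧-↑ : ∀ ℓ q η → ⟦ ℓ ⟧ (q ↑ η) ≡ ⟦ ℓ ⟧ q + ι (Coeffs.yCoeff ℓ) * η
  ⟦⟧-↑ ⟨ a , b , c ⟩ (x , y) η =
    solve 6 (λ A B C x y η → A :* x :+ B :* (y :+ η) :+ C := A :* x :+ B :* y :+ C :+ B :* η)
      refl (ι a) (ι b) (ι c) x y η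

  dist²-↑ : ∀ q η → dist² (q ↑ η) q ≡ η * η
  dist²-↑ (x , y) η = begin
    (x - x) * (x - x) + ((y + η) - y) * ((y + η) - y)  ≡⟨ cong₂ (λ a b → a * a + b * b) (-‿inverseʳ x) y+η-y≡η ⟩
    0# * 0# + η * η                                    ≡⟨ cong (_+ η * η) (zeroˡ 0#) ⟩
    0# + η * η                                         ≡⟨ +-identityˡ (η * η) ⟩
    η * η                                              ∎
    where
    open ≡-Reasoning
    y+η-y≡η : (y + η) - y ≡ η
    y+η-y≡η = trans (trans (+-assoc y η (- y)) (cong (y +_) (+-comm η (- y))))
                    (trans (sym (+-assoc y (- y) η)) (trans (cong (_+ η) (-‿inverseʳ y)) (+-identityˡ η)))

  ↑-leaves : ∀ H {z η} → ⟦ lhs H ⟧ z ≡ ⟦ rhs H ⟧ z →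
             ι (Coeffs.yCoeff (rhs H)) * η < ι (Coeffs.yCoeff (lhs H)) * η → ¬ (z ↑ η) ∈ᴴ H
  ↑-leaves H {z} {η} onLine steeper inside = ≤⇒≯ inside (begin-strict
    ⟦ rhs H ⟧ (z ↑ η)                              ≡⟨ ⟦⟧-↑ (rhs H) z η ⟩
    ⟦ rhs H ⟧ z + ι (Coeffs.yCoeff (rhs H)) * η   <⟨ +-monoˡ-< (⟦ rhs H ⟧ z) steeper ⟩
    ⟦ rhs H ⟧ z + ι (Coeffs.yCoeff (lhs H)) * η   ≡⟨ cong (_+ ι (Coeffs.yCoeff (lhs H)) * η) onLine ⟨
    ⟦ lhs H ⟧ z + ι (Coeffs.yCoeff (lhs H)) * η   ≡⟨ ⟦⟧-↑ (lhs H) z η ⟨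
    ⟦ lhs H ⟧ (z ↑ η)                              ∎)
    where open <-Reasoning

  -- A small vertical step from z leaves H, as the boundary line of H is not vertical.
  onLine-not-interior : ∀ {I : Set} {is : List I} {S : I → Set} {p : I → Point} {z} H →
    (∀ i → S i → p i ∈ᴴ H) → ⟦ lhs H ⟧ z ≡ ⟦ rhs H ⟧ z →
    Coeffs.yCoeff (lhs H) ≢ Coeffs.yCoeff (rhs H) → ¬ InInteriorOfHull is S p z
  onLine-not-interior {is = is} {z = z} H generators onLine slopes (ε , 0<ε , ball) =
    let η , close , steeper = step in
    ↑-leaves H onLine steeper
      (hull-⊆ᴴ {is = is} H generators (ball (z ↑ η) (subst (_< ε * ε) (sym (dist²-↑ z η)) close)))
    where
    b₁ = Coeffs.yCoeff (lhs H)
    b₂ = Coeffs.yCoeff (rhs H)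
    δ = half * ε
    0<δ : 0# < δ
    0<δ = *-pos 0<half 0<ε
    δ²<ε² : δ * δ < ε * ε
    δ²<ε² = <-trans (*-monoˡ-< 0<δ (half-< 0<ε)) (*-monoʳ-< 0<ε (half-< 0<ε))
    step : Σ Carrier λ η → η * η < ε * ε × ι b₂ * η < ι b₁ * η
    step with ℕₚ.<-cmp b₁ b₂
    ... | tri< b₁<b₂ _ _ = - δ , subst (_< ε * ε) (sym (neg*neg δ)) δ²<ε² ,
      subst₂ _<_ (-‿distribʳ-* (ι b₂) δ) (-‿distribʳ-* (ι b₁) δ)
        (neg-antitone (*-monoʳ-< 0<δ (ι-mono-< b₁<b₂)))
    ... | tri≈ _ b₁≡b₂ _ = ⊥-elim (slopes b₁≡b₂)
    ... | tri> _ _ b₂<b₁ = δ , δ²<ε² , *-monoʳ-< 0<δ (ι-mono-< b₂<b₁)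

  pt : ℕ → Point
  pt s = ι s , ι (s ℕ.* s)

  pt-injective : ∀ {s t} → pt s ≡ pt t → s ≡ t
  pt-injective = ι-injective ∘ cong proj₁

  ⟦⟧-pt : ∀ ℓ s → ⟦ ℓ ⟧ (pt s) ≡ ι (ℓ at s)
  ⟦⟧-pt ⟨ a , b , c ⟩ s = sym (begin
    ι (a ℕ.* s ℕ.+ b ℕ.* (s ℕ.* s) ℕ.+ c)       ≡⟨ ι-+ (a ℕ.* s ℕ.+ b ℕ.* (s ℕ.* s)) c ⟩
    ι (a ℕ.* s ℕ.+ b ℕ.* (s ℕ.* s)) + ι c       ≡⟨ cong (_+ ι c) (ι-+ (a ℕ.* s) (b ℕ.* (s ℕ.* s))) ⟩
    ι (a ℕ.* s) + ι (b ℕ.* (s ℕ.* s)) + ι c     ≡⟨ cong₂ (λ x y → x + y + ι c) (ι-* a s) (ι-* b (s ℕ.* s)) ⟩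
    ι a * ι s + ι b * ι (s ℕ.* s) + ι c         ∎)
    where open ≡-Reasoning

  ⟦⟧-midpoint : ∀ ℓ p q → ⟦ ℓ ⟧ (midpoint p q) ≡ half * (⟦ ℓ ⟧ p + ⟦ ℓ ⟧ q)
  ⟦⟧-midpoint ⟨ a , b , c ⟩ (x₁ , y₁) (x₂ , y₂) = sym (begin
    half * (A * x₁ + B * y₁ + C + (A * x₂ + B * y₂ + C))
      ≡⟨ solve 8 (λ h A B C x₁ y₁ x₂ y₂ →
                   h :* (A :* x₁ :+ B :* y₁ :+ C :+ (A :* x₂ :+ B :* y₂ :+ C))
                     := A :* (h :* (x₁ :+ x₂)) :+ B :* (h :* (y₁ :+ y₂)) :+ h :* (C :+ C))
           refl half A B C x₁ y₁ x₂ y₂ ⟩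
    A * (half * (x₁ + x₂)) + B * (half * (y₁ + y₂)) + half * (C + C)
      ≡⟨ cong (A * (half * (x₁ + x₂)) + B * (half * (y₁ + y₂)) +_) (half-+ C) ⟩
    A * (half * (x₁ + x₂)) + B * (half * (y₁ + y₂)) + C ∎)
    where
    open ≡-Reasoning
    A = ι a ; B = ι b ; C = ι c

  ⟦⟧-midpoint-pt : ∀ ℓ s t → ⟦ ℓ ⟧ (midpoint (pt s) (pt t)) ≡ half * ι (ℓ at s ℕ.+ ℓ at t)
  ⟦⟧-midpoint-pt ℓ s t = trans (⟦⟧-midpoint ℓ (pt s) (pt t))
    (cong (half *_) (trans (cong₂ _+_ (⟦⟧-pt ℓ s) (⟦⟧-pt ℓ t)) (sym (ι-+ (ℓ at s) (ℓ at t)))))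

  Contains⇒∈ᴴ : ∀ H {s t} → Contains H s t → midpoint (pt s) (pt t) ∈ᴴ H
  Contains⇒∈ᴴ H {s} {t} contains =
    subst₂ _≤_ (sym (⟦⟧-midpoint-pt (lhs H) s t)) (sym (⟦⟧-midpoint-pt (rhs H) s t))
      (*-monoˡ-≤ (inj₁ 0<half) (ι-mono-≤ contains))

  OnBoundary⇒onLine : ∀ H {s t} → OnBoundary H s t →
                      ⟦ lhs H ⟧ (midpoint (pt s) (pt t)) ≡ ⟦ rhs H ⟧ (midpoint (pt s) (pt t))
  OnBoundary⇒onLine H {s} {t} onBoundary = trans (⟦⟧-midpoint-pt (lhs H) s t)
    (trans (cong (λ n → half * ι n) onBoundary) (sym (⟦⟧-midpoint-pt (rhs H) s t)))

  midpoint-diagonal : ∀ q → midpoint q q ≡ q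
  midpoint-diagonal (x , y) = cong₂ _,_ (half-+ x) (half-+ y)

  midpoint-pt-injective : ∀ {s t s′ t′} → midpoint (pt s) (pt t) ≡ midpoint (pt s′) (pt t′) →
                          (s ≡ s′ × t ≡ t′) ⊎ (s ≡ t′ × t ≡ s′)
  midpoint-pt-injective {s} {t} {s′} {t′} e = sum-sumOfSquares-injective
    (recover s t s′ t′ (cong proj₁ e)) (recover (s ℕ.* s) (t ℕ.* t) (s′ ℕ.* s′) (t′ ℕ.* t′) (cong proj₂ e))
    where
    recover : ∀ m n m′ n′ → half * (ι m + ι n) ≡ half * (ι m′ + ι n′) → m ℕ.+ n ≡ m′ ℕ.+ n′
    recover m n m′ n′ e = ι-injective (trans (ι-+ m n) (trans (half-injective e) (sym (ι-+ m′ n′))))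

  parabola-strictlyConvex : ∀ {I : Set} (is : List I) (label : I → ℕ) {v} →
    (∀ {u} → label u ≡ label v → u ≡ v) → ¬ InConvHull is (λ u → u ≢ v) (pt ∘ label) (pt (label v))
  parabola-strictlyConvex is label {v} label-injective hull =
    ≤⇒≯ (subst₂ _≤_ (⟦⟧-pt (lhs T) (label v)) (⟦⟧-pt (rhs T) (label v))
                    (hull-⊆ᴴ {is = is} T below hull))
        (ι-mono-< (tangent-above (label v)))
    where
    T = tangentHalfPlane (label v)
    below : ∀ u → u ≢ v → pt (label u) ∈ᴴ T
    below u u≢v = subst₂ _≤_ (sym (⟦⟧-pt (lhs T) (label u))) (sym (⟦⟧-pt (rhs T) (label u)))
                    (ι-mono-≤ (tangent-below (u≢v ∘ label-injective)))

module PrismDrawing (R : RealClosedField) where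

  open LabelArithmetic using (PrismLink-≢; SupportingHalfPlane; supportingHalfPlane)
  open PrismGraph using (module Labelling)
  open import Data.Nat using (ℕ; _+_; _≤_)
  open import Data.Fin using (Fin)
  open import Data.List using (allFin; cartesianProduct)
  open import Data.Product using (_×_; _,_)
  open import Data.Sum using (_⊎_; inj₁; inj₂; reduce)
  open import Function using (_∘_)
  open import Relation.Binary.PropositionalEquality
  open import Relation.Nullary using (¬_)

  module _ {k : ℕ} (2≤k : 2 ≤ k) where
    open OrderedFieldGeometry R
    open Geometry R using (Point; midpoint; InInteriorOfHull; SWDrawing)
    open Labelling 2≤k

    position : Fin (k + k) → Point
    position = pt ∘ label

    edgeMidpoint : Fin (k + k) × Fin (k + k) → Point
    edgeMidpoint (u , v) = midpoint (position u) (position v)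

    private
      edges = cartesianProduct (allFin (k + k)) (allFin (k + k))
      IsEdge : Fin (k + k) × Fin (k + k) → Set
      IsEdge (u , v) = PrismAdj k u v

    midpoint-on-boundary : ∀ u v → PrismAdj k u v →
                           ¬ InInteriorOfHull edges IsEdge edgeMidpoint (edgeMidpoint (u , v))
    midpoint-on-boundary u v a =
      onLine-not-interior {is = edges} {IsEdge} {edgeMidpoint} halfPlane
        (λ { (u′ , v′) a′ → Contains⇒∈ᴴ halfPlane (contains-links (label-link a′)) })
        (OnBoundary⇒onLine halfPlane onBoundary) slopes-differ
      where open SupportingHalfPlane (supportingHalfPlane 2≤k (label-link a))

    midpoint-injective : ∀ u v u′ v′ →
      midpoint (position u) (position v) ≡ midpoint (position u′) (position v′) →
      (u ≡ u′ × v ≡ v′) ⊎ (u ≡ v′ × v ≡ u′)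
    midpoint-injective u v u′ v′ e with midpoint-pt-injective {label u} {label v} {label u′} {label v′} e
    ... | inj₁ (lu≡lu′ , lv≡lv′) = inj₁ (label-injective lu≡lu′ , label-injective lv≡lv′)
    ... | inj₂ (lu≡lv′ , lv≡lu′) = inj₂ (label-injective lu≡lv′ , label-injective lv≡lu′)

    midpoint-not-vertex : ∀ u v w → PrismAdj k u v → midpoint (position u) (position v) ≢ position w
    midpoint-not-vertex u v w a e
      with reduce (midpoint-pt-injective {label u} {label v} {label w} {label w}
                     (trans e (sym (midpoint-diagonal (position w)))))
    ... | lu≡lw , lv≡lw = PrismLink-≢ (label-link a) (trans lu≡lw (sym lv≡lw))

    drawing : SWDrawing (k + k) (PrismAdj k)
    drawing = record
      { pos             = position
      ; pos-injective   = λ u v u≢v → u≢v ∘ label-injective ∘ pt-injective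
      ; mid-injective   = λ u v u′ v′ _ _ → midpoint-injective u v u′ v′
      ; mid-not-vertex  = midpoint-not-vertex
      ; strictly-convex = λ v → parabola-strictlyConvex (allFin (k + k)) label label-injective
      ; weakly-convex   = midpoint-on-boundary
      }

open import Data.Nat using (ℕ; _≤_; _+_; _*_)
open import Data.Nat.Properties using (+-identityʳ; ≤-trans; n≤1+n)
open import Data.Product using (_×_; Σ; _,_)
open import Relation.Binary.PropositionalEquality using (subst; cong; sym)
open PrismGraph using (prism; prism-threeRegular)

theorem11 : (R : RealClosedField) →
    ((k : ℕ) → 3 ≤ k → InGsw R (k + k) (PrismAdj k)) ×
    ((m : ℕ) → 3 ≤ m →
      Σ (SimpleGraph (2 * m)) λ G → ThreeRegular G × InGsw R (2 * m) (SimpleGraph.Adj G))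
theorem11 R = (λ k 3≤k → drawing (3≤⇒2≤ 3≤k)) , cubic
  where
  open PrismDrawing R using (drawing)
  3≤⇒2≤ : ∀ {k} → 3 ≤ k → 2 ≤ k
  3≤⇒2≤ = ≤-trans (n≤1+n 2)
  Cubic : ℕ → Set₁
  Cubic n = Σ (SimpleGraph n) λ G → ThreeRegular G × InGsw R n (SimpleGraph.Adj G)
  cubic : (m : ℕ) → 3 ≤ m → Cubic (2 * m)
  cubic m 3≤m = subst Cubic (cong (m +_) (sym (+-identityʳ m)))
    (prism (3≤⇒2≤ 3≤m) , prism-threeRegular (3≤⇒2≤ 3≤m) 3≤m , drawing (3≤⇒2≤ 3≤m))
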